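{- Let $\rhd$ be a Set-Set logic over the signature $\{\land,\lor,{\sim},\circ,\bot,\top,\Rightarrow\}$ which is a conservative expansion of $\mathcal{PP}^{\rhd}_{\le}$ and in which $\Rightarrow$ is a classic-like implication. Then $\rhd_{\mathfrak M^{\Rightarrow_{A1}}}\subseteq\rhd$.
   Context: Let $\mathcal{V}_6=\{\hat{\mathbf f},\mathbf f,\mathbf n,\mathbf b,\mathbf t,\hat{\mathbf t}\}$, partially ordered as a bounded distributive lattice by $\hat{\mathbf f}<\mathbf f<\mathbf n<\mathbf t<\hat{\mathbf t}$ and $\mathbf f<\mathbf b<\mathbf t$, with $\mathbf n,\mathbf b$ incomparable. $\mathbf{PP}_6$ is the algebra on $\mathcal V_6$ in the signature $\{\land,\lor,{\sim},\circ,\bot,\top\}$ where $\land,\lor$ are meet and join, $\bot=\hat{\mathbf f}$, $\top=\hat{\mathbf t}$, ${\sim}$ swaps $\mathbf f\leftrightarrow\mathbf t$ and $\hat{\mathbf f}\leftrightarrow\hat{\mathbf t}$ and fixes $\mathbf n,\mathbf b$, and ${\circ}a=\hat{\mathbf t}$ if $a\in\{\hat{\mathbf f},\hat{\mathbf t}\}$, ${\circ}a=\hat{\mathbf f}$ otherwise. ${\uparrow}\mathbf b=\{\mathbf b,\mathbf t,\hat{\mathbf t}\}$. A Set-Set logic over a signature is a generalized consequence relation on sets of formulas (built from a countably infinite set of variables). $\mathcal{PP}^{\rhd}_{\le}$ is the Set-Set order-preserving logic of the variety generated by $\mathbf{PP}_6$ (i.e. $\Phi\rhd\Psi$ iff for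 some finite $\Phi'\subseteq\Phi$, $\Psi'\subseteq\Psi$, the inequality $\bigwedge\Phi'\le\bigvee\Psi'$ holds under all valuations in $\mathbf{PP}_6$, with $\bigwedge\varnothing=\top$, $\bigvee\varnothing=\bot$); it coincides with the Set-Set logic determined by the matrix $\langle\mathbf{PP}_6,{\uparrow}\mathbf b\rangle$. A PNmatrix $\langle\mathbf A,D\rangle$ is a multialgebra (connectives interpreted as maps $A^k\to\wp(A)$) with $D\subseteq A$; valuations $h$ satisfy $h(\copyright(\varphi_1,\dots,\varphi_k))\in\copyright^{\mathbf A}(h(\varphi_1),\dots,h(\varphi_k))$; $\Phi\rhd_{\langle\mathbf A,D\rangle}\Psi$ iff every valuation $h$ has $h(\varphi)\notin D$ for some $\varphi\in\Phi$ or $h(\psi)\in D$ for some $\psi\in\Psi$. $\mathfrak M^{\Rightarrow_{A1}}=\langle\mathbf{PP}_6^{\Rightarrow_{A1}},{\uparrow}\mathbf b\rangle$ where $\mathbf{PP}_6^{\Rightarrow_{A1}}$ expands $\mathbf{PP}_6$ by the multioperation $a\Rightarrow_{A1}b={\uparrow}\mathbf b$ if $a\notin{\uparrow}\mathbf b$ or $b\in{\uparrow}\mathbf b$, and $=\mathcal V_6\setminus{\uparrow}\mathbf b$ otherwise. $\rhd'$ over the larger signature is a conservative expansion of $\rhd$ if $\rhd\subseteq\rhd'$ and, for sets $\Phi,\Psi$ of formulas of the smaller signature, $\Phi\rhd'\Psi$ iff $\Phi\rhd\Psi$. $\Rightarrow$ is a classic-like implication in $\rhd$ if for all sets $\Phi,\Psi$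 and formulas $\varphi,\psi$: $\Phi\cup\{\varphi\}\rhd\{\psi\}\cup\Psi$ iff $\Phi\rhd\{\varphi\Rightarrow\psi\}\cup\Psi$. -}

module Defs where

open import Data.Nat using (ℕ)
open import Data.Bool using (Bool; true; false; if_then_else_; _∨_; not)
open import Data.List using (List; []; _∷_; map; foldr)
open import Data.List.Relation.Unary.All using (All)
open import Data.Product using (Σ; _×_; _,_)
open import Data.Sum using (_⊎_)
open import Relation.Nullary using (¬_; Dec)
open import Relation.Binary.PropositionalEquality using (_≡_)
open import Function.Bundles using (_⇔_)

data V6 : Set where
  f̂ f n b t t̂ : V6

leq : V6 → V6 → Bool
leq f̂ _  = true
leq f f̂  = false
leq f _  = true
leq n n  = true
leq n t  = true
leq n t̂  = true
leq n _  = false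
leq b b  = true
leq b t  = true
leq b t̂  = true
leq b _  = false
leq t t  = true
leq t t̂  = true
leq t _  = false
leq t̂ t̂  = true
leq t̂ _  = false

_≤V_ : V6 → V6 → Set
x ≤V y = leq x y ≡ true

-- meet and join (the only incomparable pair is n, b, with meet f and join t)
meet : V6 → V6 → V6
meet x y = if leq x y then x else (if leq y x then y else f)

join : V6 → V6 → V6
join x y = if leq x y then y else (if leq y x then x else t)

neg : V6 → V6
neg f̂ = t̂
neg f = t
neg n = n
neg b = b
neg t = f
neg t̂ = f̂

circ : V6 → V6
circ f̂ = t̂
circ t̂ = t̂
circ _ = f̂

upB : V6 → Bool
upB b = true
upB t = true
upB t̂ = true
upB _ = false

-- the multioperation ⇒_A1, as a membership test: impA1 x y z = true iff z ∈ x ⇒_A1 y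
impA1 : V6 → V6 → V6 → Bool
impA1 x y z = if not (upB x) ∨ upB y then upB z else not (upB z)

data Fm₀ : Set where
  var₀ : ℕ → Fm₀
  _∧₀_ _∨₀_ : Fm₀ → Fm₀ → Fm₀
  ∼₀_ ∘₀_ : Fm₀ → Fm₀
  ⊥₀ ⊤₀ : Fm₀

data Fm : Set where
  var : ℕ → Fm
  _∧'_ _∨'_ _⇒_ : Fm → Fm → Fm
  ∼_ ∘_ : Fm → Fm
  ⊥' ⊤' : Fm

ι : Fm₀ → Fm
ι (var₀ x) = var x
ι (φ ∧₀ ψ) = ι φ ∧' ι ψ
ι (φ ∨₀ ψ) = ι φ ∨' ι ψ
ι (∼₀ φ) = ∼ ι φ
ι (∘₀ φ) = ∘ ι φ
ι ⊥₀ = ⊥'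
ι ⊤₀ = ⊤'

FmSet : Set₁
FmSet = Fm → Set

_∪_ : FmSet → FmSet → FmSet
(Φ ∪ Ψ) φ = Φ φ ⊎ Ψ φ

∁ : FmSet → FmSet
∁ Ω φ = ¬ Ω φ

⟦_⟧ : Fm → FmSet
⟦ φ ⟧ ψ = ψ ≡ φ

_⊆_ : FmSet → FmSet → Set
Φ ⊆ Ψ = ∀ φ → Φ φ → Ψ φ

ι[_] : (Fm₀ → Set) → FmSet
ι[ Φ ] φ = Σ Fm₀ λ φ₀ → Φ φ₀ × ι φ₀ ≡ φ

Subst : Set
Subst = ℕ → Fm

sub : Subst → Fm → Fm
sub σ (var x) = σ x
sub σ (φ ∧' ψ) = sub σ φ ∧' sub σ ψ
sub σ (φ ∨' ψ) = sub σ φ ∨' sub σ ψ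
sub σ (φ ⇒ ψ) = sub σ φ ⇒ sub σ ψ
sub σ (∼ φ) = ∼ sub σ φ
sub σ (∘ φ) = ∘ sub σ φ
sub σ ⊥' = ⊥'
sub σ ⊤' = ⊤'

sub[_] : Subst → FmSet → FmSet
sub[ σ ] Φ ψ = Σ Fm λ φ → Φ φ × sub σ φ ≡ ψ

Rel : Set₁
Rel = FmSet → FmSet → Set

record IsSetSetLogic (_▷_ : Rel) : Set₁ where
  field
    overlapR  : ∀ Φ Ψ → (Σ Fm λ φ → Φ φ × Ψ φ) → Φ ▷ Ψ
    dilution  : ∀ Φ Ψ Φ' Ψ' → Φ ▷ Ψ → Φ ⊆ Φ' → Ψ ⊆ Ψ' → Φ' ▷ Ψ'
    cut       : ∀ Φ Ψ →
                (∀ (Ω : FmSet) → (∀ φ → Dec (Ω φ)) → (Φ ∪ Ω) ▷ (∁ Ω ∪ Ψ)) →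
                Φ ▷ Ψ
    structural : ∀ Φ Ψ (σ : Subst) → Φ ▷ Ψ → sub[ σ ] Φ ▷ sub[ σ ] Ψ

eval₀ : (ℕ → V6) → Fm₀ → V6
eval₀ v (var₀ x) = v x
eval₀ v (φ ∧₀ ψ) = meet (eval₀ v φ) (eval₀ v ψ)
eval₀ v (φ ∨₀ ψ) = join (eval₀ v φ) (eval₀ v ψ)
eval₀ v (∼₀ φ) = neg (eval₀ v φ)
eval₀ v (∘₀ φ) = circ (eval₀ v φ)
eval₀ v ⊥₀ = f̂
eval₀ v ⊤₀ = t̂

bigMeet : List V6 → V6
bigMeet = foldr meet t̂

bigJoin : List V6 → V6
bigJoin = foldr join f̂

_▷PP_ : (Fm₀ → Set) → (Fm₀ → Set) → Set
Φ ▷PP Ψ = Σ (List Fm₀) λ Φ' → Σ (List Fm₀) λ Ψ' →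
  All Φ Φ' × All Ψ Ψ' ×
  (∀ (v : ℕ → V6) → bigMeet (map (eval₀ v) Φ') ≤V bigJoin (map (eval₀ v) Ψ'))

IsValM : (Fm → V6) → Set
IsValM h =
  (∀ φ ψ → h (φ ∧' ψ) ≡ meet (h φ) (h ψ)) ×
  (∀ φ ψ → h (φ ∨' ψ) ≡ join (h φ) (h ψ)) ×
  (∀ φ → h (∼ φ) ≡ neg (h φ)) ×
  (∀ φ → h (∘ φ) ≡ circ (h φ)) ×
  (h ⊥' ≡ f̂) ×
  (h ⊤' ≡ t̂) ×
  (∀ φ ψ → impA1 (h φ) (h ψ) (h (φ ⇒ ψ)) ≡ true)

_▷M_ : Rel
Φ ▷M Ψ = ∀ (h : Fm → V6) → IsValM h →
  (Σ Fm λ φ → Φ φ × upB (h φ) ≡ false) ⊎ (Σ Fm λ ψ → Ψ ψ × upB (h ψ) ≡ true)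

-- ▷ is a conservative expansion of PP^▷_≤ (this also yields PP^▷_≤ ⊆ ▷)
ConservativeExpansionOfPP : Rel → Set₁
ConservativeExpansionOfPP _▷_ =
  ∀ (Φ Ψ : Fm₀ → Set) → (ι[ Φ ] ▷ ι[ Ψ ]) ⇔ (Φ ▷PP Ψ)

ClassicLike : Rel → Set₁
ClassicLike _▷_ =
  ∀ (Φ Ψ : FmSet) (φ ψ : Fm) →
    ((Φ ∪ ⟦ φ ⟧) ▷ (⟦ ψ ⟧ ∪ Ψ)) ⇔ (Φ ▷ (⟦ φ ⇒ ψ ⟧ ∪ Ψ))

module Submission where

-- By cut it suffices to show, for every decidable set Ω, that Ω ▷ ∁ Ω or that
-- membership in Ω is designation under some valuation of 𝔐^{⇒A1}.  A value z of
-- PP₆ is determined by its profile: whether z, ∼ z and ∘ z are designated.  Read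
-- off Ω the profile of every formula χ (is χ, ∼ χ, ∘ χ in Ω?).  Each way in which
-- these profiles could fail to be profiles of values, or to follow the tables of
-- ∧, ∨, ∼, ∘, ⊥, ⊤, is ruled out by a PP₆-valid sequent between literals, which by
-- conservativity and structurality yields Ω ▷ ∁ Ω.  Likewise classic-likeness makes
-- membership of φ ⇒ ψ in Ω classical in that of φ and ψ, which is all ⇒_A1
-- prescribes.  So, unless Ω ▷ ∁ Ω, the values named by the profiles form a
-- valuation h with h χ ∈ ↑b exactly when χ ∈ Ω.

open import Defs
open import Data.Nat using (ℕ; zero; suc)
open import Data.Bool using (Bool; true; false; T; _∧_; _∨_; not)
open import Data.Bool.ListAction using (all)
open import Data.Bool.Properties using (T-∧; T-∨; T-≡) renaming (_≟_ to _≟ᴮ_)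
open import Data.List using (List; []; _∷_; map; _++_)
open import Data.List.Membership.Propositional using (_∈_)
open import Data.List.Properties using (map-cong-local)
open import Data.List.Relation.Unary.All as All using (All; []; _∷_; lookup)
open import Data.List.Relation.Unary.All.Properties using (all⁺; ++⁺)
open import Data.List.Relation.Unary.Any using (here; there)
open import Data.Product using (Σ; _×_; _,_; proj₁)
open import Data.Product.Properties using (≡-dec)
open import Data.Sum using (_⊎_; inj₁; inj₂; [_,_]′)
import Data.Sum.Effectful.Left as SumLeft
open import Effect.Monad using (RawMonad)
open import Function using (_∘_; case_of_)
open import Function.Bundles using (Equivalence)
open import Level using (0ℓ)
open import Relation.Binary.Definitions using (DecidableEquality)
open import Relation.Binary.PropositionalEquality
  using (_≡_; _≢_; refl; sym; trans; cong; cong₂; subst; subst₂)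
open import Relation.Nullary using (¬_; Dec; yes; no; does; contradiction)
open import Relation.Nullary.Decidable using (⌊_⌋; map′; toWitness)
open import Relation.Unary using (∅)

Profile : Set
Profile = Bool × Bool × Bool

profile : V6 → Profile
profile z = upB z , upB (neg z) , upB (circ z)

-- (true , true , true) and (false , false , true) are not profiles of values;
-- they are sent to arbitrary values.
fromProfile : Profile → V6
fromProfile (true  , true  , _)     = b
fromProfile (true  , false , true)  = t̂
fromProfile (true  , false , false) = t
fromProfile (false , true  , true)  = f̂
fromProfile (false , true  , false) = f
fromProfile (false , false , _)     = n

fromProfile-profile : ∀ z → fromProfile (profile z) ≡ z
fromProfile-profile f̂ = refl
fromProfile-profile f = refl
fromProfile-profile n = refl
fromProfile-profile b = refl
fromProfile-profile t = refl
fromProfile-profile t̂ = refl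

upB-fromProfile : ∀ u m c → upB (fromProfile (u , m , c)) ≡ u
upB-fromProfile true  true  _     = refl
upB-fromProfile true  false true  = refl
upB-fromProfile true  false false = refl
upB-fromProfile false true  true  = refl
upB-fromProfile false true  false = refl
upB-fromProfile false false _     = refl

_≟V_ : DecidableEquality V6
x ≟V y = map′ injective (cong profile) (≡-dec _≟ᴮ_ (≡-dec _≟ᴮ_ _≟ᴮ_) (profile x) (profile y))
  where
  injective : profile x ≡ profile y → x ≡ y
  injective eq = trans (sym (fromProfile-profile x))
                       (trans (cong fromProfile eq) (fromProfile-profile y))

impA1-classical : ∀ x y m c → impA1 x y (fromProfile (not (upB x) ∨ upB y , m , c)) ≡ true
impA1-classical x y m c with not (upB x) ∨ upB y
... | true  = upB-fromProfile true m c
... | false = cong not (upB-fromProfile false m c)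

V6-values : List V6
V6-values = f̂ ∷ f ∷ n ∷ b ∷ t ∷ t̂ ∷ []

∈-V6-values : ∀ x → x ∈ V6-values
∈-V6-values f̂ = here refl
∈-V6-values f = there (here refl)
∈-V6-values n = there (there (here refl))
∈-V6-values b = there (there (there (here refl)))
∈-V6-values t = there (there (there (there (here refl))))
∈-V6-values t̂ = there (there (there (there (there (here refl)))))

everyV : (V6 → Bool) → Bool
everyV p = all p V6-values

everyV-sound : ∀ p → T (everyV p) → ∀ x → T (p x)
everyV-sound p holds x = lookup (all⁺ p V6-values holds) (∈-V6-values x)

-- Sequents of literals: (α , true) is the premise α, (α , false) the conclusion α.
Sequent : Set
Sequent = List (Fm₀ × Bool)

premises : Sequent → List Fm₀
premises []                = []
premises ((α , true)  ∷ ls) = α ∷ premises ls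
premises ((α , false) ∷ ls) = premises ls

conclusions : Sequent → List Fm₀
conclusions []                = []
conclusions ((α , true)  ∷ ls) = conclusions ls
conclusions ((α , false) ∷ ls) = α ∷ conclusions ls

PPValid : Sequent → Set
PPValid ls =
  ∀ v → bigMeet (map (eval₀ v) (premises ls)) ≤V bigJoin (map (eval₀ v) (conclusions ls))

p₀ p₁ : Fm₀
p₀ = var₀ 0
p₁ = var₀ 1

inTwoVars : Fm₀ → Bool
inTwoVars (var₀ zero)          = true
inTwoVars (var₀ (suc zero))    = true
inTwoVars (var₀ (suc (suc _))) = false
inTwoVars (φ ∧₀ ψ)             = inTwoVars φ ∧ inTwoVars ψ
inTwoVars (φ ∨₀ ψ)             = inTwoVars φ ∧ inTwoVars ψ
inTwoVars (∼₀ φ)               = inTwoVars φ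
inTwoVars (∘₀ φ)               = inTwoVars φ
inTwoVars ⊥₀                   = true
inTwoVars ⊤₀                   = true

pairVal : V6 → V6 → ℕ → V6
pairVal x y zero    = x
pairVal x y (suc _) = y

eval₀-inTwoVars : ∀ v α → T (inTwoVars α) → eval₀ v α ≡ eval₀ (pairVal (v 0) (v 1)) α
eval₀-inTwoVars v (var₀ zero)       _ = refl
eval₀-inTwoVars v (var₀ (suc zero)) _ = refl
eval₀-inTwoVars v (φ ∧₀ ψ) inφψ with Equivalence.to T-∧ inφψ
... | inφ , inψ = cong₂ meet (eval₀-inTwoVars v φ inφ) (eval₀-inTwoVars v ψ inψ)
eval₀-inTwoVars v (φ ∨₀ ψ) inφψ with Equivalence.to T-∧ inφψ
... | inφ , inψ = cong₂ join (eval₀-inTwoVars v φ inφ) (eval₀-inTwoVars v ψ inψ)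
eval₀-inTwoVars v (∼₀ φ) inφ = cong neg (eval₀-inTwoVars v φ inφ)
eval₀-inTwoVars v (∘₀ φ) inφ = cong circ (eval₀-inTwoVars v φ inφ)
eval₀-inTwoVars v ⊥₀     _   = refl
eval₀-inTwoVars v ⊤₀     _   = refl

validAt : Sequent → V6 → V6 → Bool
validAt ls x y = leq (bigMeet (map (eval₀ (pairVal x y)) (premises ls)))
                     (bigJoin (map (eval₀ (pairVal x y)) (conclusions ls)))

checkValid : Sequent → Bool
checkValid ls =
  (all inTwoVars (premises ls) ∧ all inTwoVars (conclusions ls)) ∧
  everyV (everyV ∘ validAt ls)

checkValid-sound : ∀ ls → T (checkValid ls) → PPValid ls
checkValid-sound ls ok v with Equivalence.to T-∧ ok
... | inTwo , validOnPairs with Equivalence.to T-∧ inTwo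
... | premisesInTwo , conclusionsInTwo =
  subst₂ _≤V_ (cong bigMeet (sym (restrict (premises ls) premisesInTwo)))
              (cong bigJoin (sym (restrict (conclusions ls) conclusionsInTwo)))
    (Equivalence.to T-≡ (everyV-sound (validAt ls (v 0))
                          (everyV-sound (everyV ∘ validAt ls) validOnPairs (v 0)) (v 1)))
  where
  restrict : ∀ αs → T (all inTwoVars αs) →
             map (eval₀ v) αs ≡ map (eval₀ (pairVal (v 0) (v 1))) αs
  restrict αs inTwoVars-αs =
    map-cong-local (All.map (λ {α} → eval₀-inTwoVars v α) (all⁺ inTwoVars αs inTwoVars-αs))

literals : Fm₀ → Profile → Sequent
literals α (u , m , c) = (α , u) ∷ (∼₀ α , m) ∷ (∘₀ α , c) ∷ []

not-profile₁ : PPValid (literals p₀ (true , true , true))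
not-profile₁ = checkValid-sound (literals p₀ (true , true , true)) _

not-profile₂ : PPValid (literals p₀ (false , false , true))
not-profile₂ = checkValid-sound (literals p₀ (false , false , true)) _

-- The sequent excluding that p₀, p₁, c₀ take the values x, y, z (profiles
-- determine values).
tableSequent : Fm₀ → V6 → V6 → V6 → Sequent
tableSequent c₀ x y z =
  literals p₀ (profile x) ++ literals p₁ (profile y) ++ literals c₀ (profile z)

Table : Fm₀ → (V6 → V6 → V6) → Set
Table c₀ op = ∀ x y z → z ≢ op x y → PPValid (tableSequent c₀ x y z)

tableEntry : Fm₀ → (V6 → V6 → V6) → V6 → V6 → V6 → Bool
tableEntry c₀ op x y z = ⌊ z ≟V op x y ⌋ ∨ checkValid (tableSequent c₀ x y z)

checkTable : Fm₀ → (V6 → V6 → V6) → Bool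
checkTable c₀ op = everyV λ x → everyV λ y → everyV (tableEntry c₀ op x y)

checkTable-sound : ∀ c₀ op → T (checkTable c₀ op) → Table c₀ op
checkTable-sound c₀ op ok x y z z≢op =
  [ (λ z≡op → contradiction (toWitness z≡op) z≢op) , checkValid-sound (tableSequent c₀ x y z) ]′
    (Equivalence.to (T-∨ {⌊ z ≟V op x y ⌋}) entry)
  where
  entry : T (tableEntry c₀ op x y z)
  entry = everyV-sound (tableEntry c₀ op x y)
            (everyV-sound (λ y → everyV (tableEntry c₀ op x y))
              (everyV-sound (λ x → everyV λ y → everyV (tableEntry c₀ op x y)) ok x) y) z

∧-table : Table (p₀ ∧₀ p₁) meet
∧-table = checkTable-sound (p₀ ∧₀ p₁) meet _

∨-table : Table (p₀ ∨₀ p₁) join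
∨-table = checkTable-sound (p₀ ∨₀ p₁) join _

∼-table : Table (∼₀ p₀) (λ x _ → neg x)
∼-table = checkTable-sound (∼₀ p₀) (λ x _ → neg x) _

∘-table : Table (∘₀ p₀) (λ x _ → circ x)
∘-table = checkTable-sound (∘₀ p₀) (λ x _ → circ x) _

⊥-table : Table ⊥₀ (λ _ _ → f̂)
⊥-table = checkTable-sound ⊥₀ (λ _ _ → f̂) _

⊤-table : Table ⊤₀ (λ _ _ → t̂)
⊤-table = checkTable-sound ⊤₀ (λ _ _ → t̂) _

pairSubst : Fm → Fm → Subst
pairSubst φ ψ zero    = φ
pairSubst φ ψ (suc _) = ψ

module Separation (_▷_ : Rel) (logic : IsSetSetLogic _▷_)
  (conservative : ConservativeExpansionOfPP _▷_) (classicLike : ClassicLike _▷_)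
  (Ω : FmSet) (Ω? : ∀ φ → Dec (Ω φ)) where

  open IsSetSetLogic logic

  Degenerate : Set
  Degenerate = Ω ▷ ∁ Ω

  open RawMonad (SumLeft.monad Degenerate 0ℓ) using (pure; _>>=_)

  inΩ : Fm → Bool
  inΩ φ = does (Ω? φ)

  inΩ-sound : ∀ {φ} → inΩ φ ≡ true → Ω φ
  inΩ-sound {φ} eq with Ω? φ
  ... | yes φ∈Ω = φ∈Ω
  inΩ-sound () | no _

  notInΩ-sound : ∀ {φ} → inΩ φ ≡ false → ¬ Ω φ
  notInΩ-sound {φ} eq with Ω? φ
  notInΩ-sound () | yes _
  ... | no φ∉Ω = φ∉Ω

  profileΩ : Fm → Profile
  profileΩ φ = inΩ φ , inΩ (∼ φ) , inΩ (∘ φ)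

  Reads : Fm → V6 → Set
  Reads φ z = profileΩ φ ≡ profile z

  Satisfies : Subst → Sequent → Set
  Satisfies σ = All (λ (α , s) → inΩ (sub σ (ι α)) ≡ s)

  satisfies-reading : ∀ σ α {p} → profileΩ (sub σ (ι α)) ≡ p → Satisfies σ (literals α p)
  satisfies-reading σ α refl = refl ∷ refl ∷ refl ∷ []

  inΩ-reads : ∀ {φ z} → Reads φ z → inΩ φ ≡ upB z
  inΩ-reads = cong proj₁

  fromProfile-reads : ∀ {φ z} → Reads φ z → fromProfile (profileΩ φ) ≡ z
  fromProfile-reads {z = z} rφ = trans (cong fromProfile rφ) (fromProfile-profile z)

  premises-inΩ : ∀ {σ} ls → Satisfies σ ls → All (λ α → Ω (sub σ (ι α))) (premises ls)
  premises-inΩ []                 []         = []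
  premises-inΩ ((α , true)  ∷ ls) (eq ∷ sat) = inΩ-sound eq ∷ premises-inΩ ls sat
  premises-inΩ ((α , false) ∷ ls) (_  ∷ sat) = premises-inΩ ls sat

  conclusions-notInΩ : ∀ {σ} ls → Satisfies σ ls → All (λ α → ¬ Ω (sub σ (ι α))) (conclusions ls)
  conclusions-notInΩ []                 []         = []
  conclusions-notInΩ ((α , true)  ∷ ls) (_  ∷ sat) = conclusions-notInΩ ls sat
  conclusions-notInΩ ((α , false) ∷ ls) (eq ∷ sat) = notInΩ-sound eq ∷ conclusions-notInΩ ls sat

  satisfied-valid⇒degenerate : ∀ σ ls → PPValid ls → Satisfies σ ls → Degenerate
  satisfied-valid⇒degenerate σ ls valid sat =
    dilution _ _ Ω (∁ Ω)
      (structural _ _ σ (Equivalence.from (conservative Φ₀ Ψ₀)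
        (premises ls , conclusions ls , premises-inΩ ls sat , conclusions-notInΩ ls sat , valid)))
      (λ { _ (_ , (_ , α∈Φ₀ , refl) , refl) → α∈Φ₀ })
      (λ { _ (_ , (_ , α∈Ψ₀ , refl) , refl) → α∈Ψ₀ })
    where
    Φ₀ Ψ₀ : Fm₀ → Set
    Φ₀ α = Ω (sub σ (ι α))
    Ψ₀ α = ¬ Ω (sub σ (ι α))

  valid-profile⇒degenerate : ∀ φ {p} → PPValid (literals p₀ p) → profileΩ φ ≡ p → Degenerate
  valid-profile⇒degenerate φ valid rφ =
    satisfied-valid⇒degenerate (λ _ → φ) _ valid (satisfies-reading (λ _ → φ) p₀ rφ)

  reads-some : ∀ φ → Degenerate ⊎ Σ V6 (Reads φ)
  reads-some φ with profileΩ φ in rφ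
  ... | true  , true  , true  = inj₁ (valid-profile⇒degenerate φ not-profile₁ rφ)
  ... | false , false , true  = inj₁ (valid-profile⇒degenerate φ not-profile₂ rφ)
  ... | true  , true  , false = inj₂ (b , refl)
  ... | true  , false , true  = inj₂ (t̂ , refl)
  ... | true  , false , false = inj₂ (t , refl)
  ... | false , true  , true  = inj₂ (f̂ , refl)
  ... | false , true  , false = inj₂ (f , refl)
  ... | false , false , false = inj₂ (n , refl)

  connective-step : ∀ {c₀ op} → Table c₀ op → ∀ φ ψ {x y} → Reads φ x → Reads ψ y →
                    Degenerate ⊎ Reads (sub (pairSubst φ ψ) (ι c₀)) (op x y)
  connective-step {c₀} {op} table φ ψ {x} {y} rφ rψ = do
    (z , rχ) ← reads-some (sub σ (ι c₀))
    case z ≟V op x y of λ where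
      (yes refl) → pure rχ
      (no z≢op) → inj₁ (satisfied-valid⇒degenerate σ (tableSequent c₀ x y z) (table x y z z≢op)
        (++⁺ (satisfies-reading σ p₀ rφ)
          (++⁺ (satisfies-reading σ p₁ rψ) (satisfies-reading σ c₀ rχ))))
    where
    σ : Subst
    σ = pairSubst φ ψ

  -- The three degenerate cases are the sequents φ ⇒ ψ, φ ▷ ψ and ▷ φ, φ ⇒ ψ and
  -- ψ ▷ φ ⇒ ψ, each obtained from an overlap by classic-likeness.
  ⇒-classical : ∀ φ ψ → Degenerate ⊎ inΩ (φ ⇒ ψ) ≡ not (inΩ φ) ∨ inΩ ψ
  ⇒-classical φ ψ with inΩ φ in eφ | inΩ ψ in eψ | inΩ (φ ⇒ ψ) in eχ
  ... | true  | true  | true  = inj₂ refl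
  ... | true  | false | false = inj₂ refl
  ... | false | true  | true  = inj₂ refl
  ... | false | false | true  = inj₂ refl
  ... | true  | false | true  = inj₁ (dilution _ _ Ω (∁ Ω)
          (Equivalence.from (classicLike ⟦ φ ⇒ ψ ⟧ ∅ φ ψ) (overlapR _ _ (φ ⇒ ψ , refl , inj₁ refl)))
          (λ { _ (inj₁ refl) → inΩ-sound eχ ; _ (inj₂ refl) → inΩ-sound eφ })
          (λ { _ (inj₁ refl) → notInΩ-sound eψ }))
  ... | false | _     | false = inj₁ (dilution _ _ Ω (∁ Ω)
          (Equivalence.to (classicLike ∅ ⟦ φ ⟧ φ ψ) (overlapR _ _ (φ , inj₂ refl , inj₂ refl)))
          (λ { _ () })
          (λ { _ (inj₁ refl) → notInΩ-sound eχ ; _ (inj₂ refl) → notInΩ-sound eφ }))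
  ... | true  | true  | false = inj₁ (dilution _ _ Ω (∁ Ω)
          (Equivalence.to (classicLike ⟦ ψ ⟧ ∅ φ ψ) (overlapR _ _ (ψ , inj₁ refl , inj₁ refl)))
          (λ { _ refl → inΩ-sound eψ })
          (λ { _ (inj₁ refl) → notInΩ-sound eχ }))

  h : Fm → V6
  h (var x)  = fromProfile (profileΩ (var x))
  h (φ ∧' ψ) = meet (h φ) (h ψ)
  h (φ ∨' ψ) = join (h φ) (h ψ)
  h (φ ⇒ ψ)  = fromProfile (not (upB (h φ)) ∨ upB (h ψ) , inΩ (∼ (φ ⇒ ψ)) , inΩ (∘ (φ ⇒ ψ)))
  h (∼ φ)    = neg (h φ)
  h (∘ φ)    = circ (h φ)
  h ⊥'       = f̂
  h ⊤'       = t̂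

  h-isVal : IsValM h
  h-isVal = (λ _ _ → refl) , (λ _ _ → refl) , (λ _ → refl) , (λ _ → refl) , refl , refl ,
            (λ φ ψ → impA1-classical (h φ) (h ψ) _ _)

  reads-h : ∀ φ → Degenerate ⊎ Reads φ (h φ)
  reads-h (var x) = do
    (z , rz) ← reads-some (var x)
    pure (subst (Reads (var x)) (sym (fromProfile-reads rz)) rz)
  reads-h (φ ∧' ψ) = do
    rφ ← reads-h φ
    rψ ← reads-h ψ
    connective-step ∧-table φ ψ rφ rψ
  reads-h (φ ∨' ψ) = do
    rφ ← reads-h φ
    rψ ← reads-h ψ
    connective-step ∨-table φ ψ rφ rψ
  reads-h (∼ φ) = do
    rφ ← reads-h φ
    connective-step ∼-table φ φ rφ rφ
  reads-h (∘ φ) = do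
    rφ ← reads-h φ
    connective-step ∘-table φ φ rφ rφ
  reads-h ⊥' = do
    (_ , rz) ← reads-some ⊥'
    connective-step ⊥-table ⊥' ⊥' rz rz
  reads-h ⊤' = do
    (_ , rz) ← reads-some ⊤'
    connective-step ⊤-table ⊤' ⊤' rz rz
  reads-h (φ ⇒ ψ) = do
    rφ ← reads-h φ
    rψ ← reads-h ψ
    (z , rχ) ← reads-some (φ ⇒ ψ)
    classical ← ⇒-classical φ ψ
    let designated : not (upB (h φ)) ∨ upB (h ψ) ≡ inΩ (φ ⇒ ψ)
        designated = trans (cong₂ (λ u v → not u ∨ v) (sym (inΩ-reads rφ)) (sym (inΩ-reads rψ)))
                           (sym classical)
        hχ≡z : h (φ ⇒ ψ) ≡ z
        hχ≡z = trans (cong (λ u → fromProfile (u , inΩ (∼ (φ ⇒ ψ)) , inΩ (∘ (φ ⇒ ψ)))) designated)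
                     (fromProfile-reads rχ)
    pure (subst (Reads (φ ⇒ ψ)) (sym hχ≡z) rχ)

  separates : ∀ Φ Ψ → Φ ▷M Ψ → (Φ ∪ Ω) ▷ (∁ Ω ∪ Ψ)
  separates Φ Ψ Φ▷MΨ = case Φ▷MΨ h h-isVal of λ where
      (inj₁ (φ , φ∈Φ , hφ∉↑b)) → withReading φ λ rφ →
        overlapR _ _ (φ , inj₁ φ∈Φ , inj₁ (notInΩ-sound (trans (inΩ-reads rφ) hφ∉↑b)))
      (inj₂ (ψ , ψ∈Ψ , hψ∈↑b)) → withReading ψ λ rψ →
        overlapR _ _ (ψ , inj₂ (inΩ-sound (trans (inΩ-reads rψ) hψ∈↑b)) , inj₂ ψ∈Ψ)
    where
    withReading : ∀ χ → (Reads χ (h χ) → (Φ ∪ Ω) ▷ (∁ Ω ∪ Ψ)) → (Φ ∪ Ω) ▷ (∁ Ω ∪ Ψ)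
    withReading χ k =
      [ (λ degenerate → dilution _ _ _ _ degenerate (λ _ → inj₂) (λ _ → inj₁)) , k ]′ (reads-h χ)

proposition4p7 : (_▷_ : Rel) → IsSetSetLogic _▷_ →
    ConservativeExpansionOfPP _▷_ → ClassicLike _▷_ →
    ∀ (Φ Ψ : FmSet) → Φ ▷M Ψ → Φ ▷ Ψ
proposition4p7 _▷_ logic conservative classicLike Φ Ψ Φ▷MΨ =
  IsSetSetLogic.cut logic Φ Ψ λ Ω Ω? →
    Separation.separates _▷_ logic conservative classicLike Ω Ω? Φ Ψ Φ▷MΨ
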